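{- For all configurations $c,c_1,c_2$ and lists of observable labels $\vec\lambda_1,\vec\lambda_2$: if $c\xrightarrow{\vec\lambda_1}{}^{*}c_1$, $c\xrightarrow{\vec\lambda_2}{}^{*}c_2$, and the main choreographies of the programs of $c_1$ and $c_2$ are both $\mathsf{end}$, then the states of $c_1$ and $c_2$ are extensionally equal.
   Context: Fix types with decidable equality of process names $\mathsf{Pid}$, variables $\mathsf{Var}$, values $\mathsf{Val}$, expressions, Boolean expressions, procedure names $\mathsf{RecVar}$, annotations, and evaluation functions $\mathrm{eval}$ (expression and local state $\mathsf{Var}\to\mathsf{Val}$ to value) and $\mathrm{beval}$ (Boolean expression and local state to Boolean), invariant under extensional equality of local states. Labels: $\mathsf{left},\mathsf{right}$. A state is $s:\mathsf{Pid}\to\mathsf{Var}\to\mathsf{Val}$; $s\equiv s'$ is extensional equality; $s[q,x\mapsto v]$ is update. Interactions $\eta::=p.e\to q.x\mid p\to q[l]$ (processes $\{p,q\}$); choreographies $C::=\eta@a;C\mid\mathsf{if}\ p.b\ \mathsf{then}\ C_1\ \mathsf{else}\ C_2\mid\mathsf{call}\ X\mid\mathsf{rtcall}\ X\ ps\ C\mid\mathsf{end}$, $ps$ a list of processes. $D:\mathsf{RecVar}\to\mathrm{list}(\mathsf{Pid})\times\mathsf{Chor}$, $D\,X=(\mathrm{Vars}\,X,\mathrm{Body}\,X)$; a program is $(D,C)$ ($C$ its main choreography); a configuration is a pair (program, state). Rich labels $\mathrm{com}(p,v,q,x),\mathrm{sel}(p,q,l),\mathrm{cond}(p),\mathrm{call}(X,p)$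 with processes $\{p,q\},\{p,q\},\{p\},\{p\}$. $\langle C,s\rangle\xrightarrow{\rho}_D\langle C',s'\rangle$ is the least relation with: $\langle p.e\to q.x@a;C,s\rangle\xrightarrow{\mathrm{com}(p,v,q,x)}\langle C,s'\rangle$ if $v=\mathrm{eval}(e,s\,p)$, $s'\equiv s[q,x\mapsto v]$; $\langle p\to q[l]@a;C,s\rangle\xrightarrow{\mathrm{sel}(p,q,l)}\langle C,s'\rangle$ if $s\equiv s'$; $\langle\mathsf{if}\ p.b\ \mathsf{then}\ C_1\ \mathsf{else}\ C_2,s\rangle\xrightarrow{\mathrm{cond}(p)}\langle C_1,s'\rangle$ (resp. $C_2$) if $\mathrm{beval}(b,s\,p)$ is true (resp. false), $s\equiv s'$; $\langle\eta@a;C,s\rangle\xrightarrow{\rho}\langle\eta@a;C',s'\rangle$ if $\langle C,s\rangle\xrightarrow{\rho}\langle C',s'\rangle$ and processes of $\eta$, $\rho$ are disjoint; $\langle\mathsf{if}\ p.b\ \mathsf{then}\ C_1\ \mathsf{else}\ C_2,s\rangle\xrightarrow{\rho}\langle\mathsf{if}\ p.b\ \mathsf{then}\ C_1'\ \mathsf{else}\ C_2',s'\rangle$ if $p$ not in $\rho$ and $\langle C_i,s\rangle\xrightarrow{\rho}\langle C_i',s'\rangle$, $i=1,2$; $\langle\mathsf{rtcall}\ X\ ps\ C,s\rangle\xrightarrow{\rho}\langle\mathsf{rtcall}\ X\ ps\ C',s'\rangle$ if no process of $\rho$ is in $ps$ and $\langle C,s\rangle\xrightarrow{\rho}\langle C',s'\rangle$;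 for $s\equiv s'$, $p\in\mathrm{Vars}\,X$: $\langle\mathsf{call}\ X,s\rangle\xrightarrow{\mathrm{call}(X,p)}\langle\mathrm{Body}\,X,s'\rangle$ if $\#\mathrm{Vars}\,X=1$, and $\langle\mathsf{rtcall}\ X\ (\mathrm{Vars}\,X\setminus p)\ (\mathrm{Body}\,X),s'\rangle$ if $\#\mathrm{Vars}\,X>1$; for $s\equiv s'$, $p\in ps$: $\langle\mathsf{rtcall}\ X\ ps\ C,s\rangle\xrightarrow{\mathrm{call}(X,p)}\langle\mathsf{rtcall}\ X\ (ps\setminus p)\ C,s'\rangle$ if $\#ps>1$ and $\langle C,s'\rangle$ if $\#ps=1$ ($\#$ is list size, $\setminus p$ removes $p$). Observable labels: $\mathrm{forget}(\mathrm{com}(p,v,q,x))=\mathrm{com}(p,v,q)$, $\mathrm{forget}(\mathrm{sel}(p,q,l))=\mathrm{sel}(p,q,l)$, $\mathrm{forget}(\mathrm{cond}(p))=\mathrm{forget}(\mathrm{call}(X,p))=\tau(p)$; $((D,C),s)\xrightarrow{\mathrm{forget}(\rho)}((D,C'),s')$ iff $\langle C,s\rangle\xrightarrow{\rho}_D\langle C',s'\rangle$. Multi-step: $(P,s)\xrightarrow{[\,]}{}^{*}(P,s')$ whenever $s\equiv s'$, and $c_1\xrightarrow{\lambda::\vec\lambda}{}^{*}c_3$ if $c_1\xrightarrow{\lambda}c_2$ and $c_2\xrightarrow{\vec\lambda}{}^{*}c_3$. -}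

module Defs where

open import Data.Bool using (Bool; true; false; if_then_else_; _∧_)
open import Data.Nat using (ℕ; _>_)
open import Data.List using (List; []; _∷_; length; filter)
open import Data.List.Membership.Propositional using (_∈_; _∉_)
open import Data.Product using (_×_; _,_; proj₁; proj₂)
open import Relation.Binary.PropositionalEquality using (_≡_)
open import Relation.Binary.Definitions using (DecidableEquality)
open import Relation.Nullary using (¬?)
open import Relation.Nullary.Decidable using (⌊_⌋)

record Sig : Set₁ where
  field
    Pid Var Val Expr BExpr RecVar Ann : Set
    _≟Pid_ : DecidableEquality Pid
    _≟Var_ : DecidableEquality Var
    _≟Val_ : DecidableEquality Val
    _≟Expr_ : DecidableEquality Expr
    _≟BExpr_ : DecidableEquality BExpr
    _≟RecVar_ : DecidableEquality RecVar
    _≟Ann_ : DecidableEquality Ann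
    eval : Expr → (Var → Val) → Val
    beval : BExpr → (Var → Val) → Bool
    eval-ext : ∀ e (σ σ' : Var → Val) → (∀ x → σ x ≡ σ' x) → eval e σ ≡ eval e σ'
    beval-ext : ∀ b (σ σ' : Var → Val) → (∀ x → σ x ≡ σ' x) → beval b σ ≡ beval b σ'

data SelLabel : Set where
  left right : SelLabel

module Choreographies (S : Sig) where
  open Sig S public

  State : Set
  State = Pid → Var → Val

  _≈_ : State → State → Set
  s ≈ s' = ∀ p x → s p x ≡ s' p x

  update : State → Pid → Var → Val → State
  update s q x v p y = if ⌊ p ≟Pid q ⌋ ∧ ⌊ y ≟Var x ⌋ then v else s p y

  data Interaction : Set where
    com : Pid → Expr → Pid → Var → Interaction
    sel : Pid → Pid → SelLabel → Interaction

  pnI : Interaction → List Pid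
  pnI (com p e q x) = p ∷ q ∷ []
  pnI (sel p q l) = p ∷ q ∷ []

  data Chor : Set where
    _＠_︔_ : Interaction → Ann → Chor → Chor
    cif : Pid → BExpr → Chor → Chor → Chor
    call : RecVar → Chor
    rtcall : RecVar → List Pid → Chor → Chor
    end : Chor

  ProcDefs : Set
  ProcDefs = RecVar → List Pid × Chor

  record Program : Set where
    constructor prog
    field
      defs : ProcDefs
      main : Chor

  Config : Set
  Config = Program × State

  data RichLabel : Set where
    rcom : Pid → Val → Pid → Var → RichLabel
    rsel : Pid → Pid → SelLabel → RichLabel
    rcond : Pid → RichLabel
    rcall : RecVar → Pid → RichLabel

  pnR : RichLabel → List Pid
  pnR (rcom p v q x) = p ∷ q ∷ []
  pnR (rsel p q l) = p ∷ q ∷ []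
  pnR (rcond p) = p ∷ []
  pnR (rcall X p) = p ∷ []

  Disjoint : List Pid → List Pid → Set
  Disjoint xs ys = ∀ {r} → r ∈ xs → r ∉ ys

  _∖_ : List Pid → Pid → List Pid
  ps ∖ p = filter (λ r → ¬? (r ≟Pid p)) ps

  data Step (D : ProcDefs) : Chor → State → RichLabel → Chor → State → Set where
    s-com : ∀ {p e q x a C s s' v} → v ≡ eval e (s p) → s' ≈ update s q x v →
      Step D (com p e q x ＠ a ︔ C) s (rcom p v q x) C s'
    s-sel : ∀ {p q l a C s s'} → s ≈ s' →
      Step D (sel p q l ＠ a ︔ C) s (rsel p q l) C s'
    s-then : ∀ {p b C₁ C₂ s s'} → beval b (s p) ≡ true → s ≈ s' →
      Step D (cif p b C₁ C₂) s (rcond p) C₁ s'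
    s-else : ∀ {p b C₁ C₂ s s'} → beval b (s p) ≡ false → s ≈ s' →
      Step D (cif p b C₁ C₂) s (rcond p) C₂ s'
    s-delay-int : ∀ {η a C C' s s' ρ} → Disjoint (pnI η) (pnR ρ) →
      Step D C s ρ C' s' →
      Step D (η ＠ a ︔ C) s ρ (η ＠ a ︔ C') s'
    s-delay-if : ∀ {p b C₁ C₂ C₁' C₂' s s' ρ} → p ∉ pnR ρ →
      Step D C₁ s ρ C₁' s' → Step D C₂ s ρ C₂' s' →
      Step D (cif p b C₁ C₂) s ρ (cif p b C₁' C₂') s'
    s-delay-rt : ∀ {X ps C C' s s' ρ} → Disjoint (pnR ρ) ps →
      Step D C s ρ C' s' →
      Step D (rtcall X ps C) s ρ (rtcall X ps C') s'
    s-call-single : ∀ {X p s s'} → s ≈ s' → p ∈ proj₁ (D X) →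
      length (proj₁ (D X)) ≡ 1 →
      Step D (call X) s (rcall X p) (proj₂ (D X)) s'
    s-call-multi : ∀ {X p s s'} → s ≈ s' → p ∈ proj₁ (D X) →
      length (proj₁ (D X)) > 1 →
      Step D (call X) s (rcall X p) (rtcall X (proj₁ (D X) ∖ p) (proj₂ (D X))) s'
    s-rt-multi : ∀ {X ps C p s s'} → s ≈ s' → p ∈ ps → length ps > 1 →
      Step D (rtcall X ps C) s (rcall X p) (rtcall X (ps ∖ p) C) s'
    s-rt-single : ∀ {X ps C p s s'} → s ≈ s' → p ∈ ps → length ps ≡ 1 →
      Step D (rtcall X ps C) s (rcall X p) C s'

  data ObsLabel : Set where
    ocom : Pid → Val → Pid → ObsLabel
    osel : Pid → Pid → SelLabel → ObsLabel
    τ : Pid → ObsLabel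

  forget : RichLabel → ObsLabel
  forget (rcom p v q x) = ocom p v q
  forget (rsel p q l) = osel p q l
  forget (rcond p) = τ p
  forget (rcall X p) = τ p

  data CStep : Config → ObsLabel → Config → Set where
    cstep : ∀ {D C C' s s' ρ} → Step D C s ρ C' s' →
      CStep (prog D C , s) (forget ρ) (prog D C' , s')

  data CSteps : Config → List ObsLabel → Config → Set where
    done : ∀ {P s s'} → s ≈ s' → CSteps (P , s) [] (P , s')
    more : ∀ {c₁ c₂ c₃ l ls} → CStep c₁ l c₂ → CSteps c₂ ls c₃ → CSteps c₁ (l ∷ ls) c₃

-- Let D ⊢ C , s ⇓ t say that executing C sequentially (always the first
-- action, unfolding calls in place) from state s terminates in state t.
-- This big-step relation is deterministic. Every step of the out-of-order
-- semantics is reflected by it: if C moves to C' and C' evaluates to t, then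
-- so does C. The only non-trivial case is a step delayed under an earlier
-- action; the two commute because the processes involved are disjoint, so
-- the step neither reads nor writes what the earlier action touches.
-- Along a run that reaches end the final state is therefore the evaluation
-- result of the initial configuration, and any two such runs agree.
module Submission where

open import Defs
open import Data.Bool using (true; false)
open import Data.List using (List)
open import Data.List.Membership.Propositional using (_∉_)
open import Data.List.Relation.Unary.Any using (here; there)
open import Data.Product using (proj₁; proj₂)
open import Relation.Binary.PropositionalEquality
  using (_≡_; _≢_; _≗_; refl; sym; trans)
open import Relation.Nullary using (yes; no; contradiction)

module _ (S : Sig) where
  open Choreographies S

  ≈-sym : ∀ {s t} → s ≈ t → t ≈ s
  ≈-sym s≈t p x = sym (s≈t p x)

  ≈-trans : ∀ {s t u} → s ≈ t → t ≈ u → s ≈ u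
  ≈-trans s≈t t≈u p x = trans (s≈t p x) (t≈u p x)

  update-≢ : ∀ s {q} x v {r} → r ≢ q → update s q x v r ≗ s r
  update-≢ s {q} x v {r} r≢q y with r ≟Pid q
  ... | yes r≡q = contradiction r≡q r≢q
  ... | no _ = refl

  update-cong : ∀ {s s'} q x v → s ≈ s' → update s q x v ≈ update s' q x v
  update-cong q x v s≈s' r y with r ≟Pid q | y ≟Var x
  ... | yes _ | yes _ = refl
  ... | yes _ | no _ = s≈s' r y
  ... | no _ | _ = s≈s' r y

  update-cong-val : ∀ s q x {v w} → v ≡ w → update s q x v ≈ update s q x w
  update-cong-val s q x refl r y = refl

  update-comm : ∀ s q x v q' x' w → q ≢ q' →
    update (update s q x v) q' x' w ≈ update (update s q' x' w) q x v
  update-comm s q x v q' x' w q≢q' r y with r ≟Pid q | r ≟Pid q'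
  ... | yes refl | yes refl = contradiction refl q≢q'
  ... | yes refl | no _ = refl
  ... | no _ | yes refl = refl
  ... | no _ | no _ = refl

  eval-resp-≈ : ∀ e {s s'} p → s ≈ s' → eval e (s p) ≡ eval e (s' p)
  eval-resp-≈ e {s} {s'} p s≈s' = eval-ext e (s p) (s' p) (s≈s' p)

  beval-resp-≈ : ∀ b {s s'} p → s ≈ s' → beval b (s p) ≡ beval b (s' p)
  beval-resp-≈ b {s} {s'} p s≈s' = beval-ext b (s p) (s' p) (s≈s' p)

  data _⊢_,_⇓_ (D : ProcDefs) : Chor → State → State → Set where
    ⇓-end : ∀ {s t} → s ≈ t → D ⊢ end , s ⇓ t
    ⇓-com : ∀ {p e q x a C s t} → D ⊢ C , update s q x (eval e (s p)) ⇓ t →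
      D ⊢ com p e q x ＠ a ︔ C , s ⇓ t
    ⇓-sel : ∀ {p q l a C s t} → D ⊢ C , s ⇓ t → D ⊢ sel p q l ＠ a ︔ C , s ⇓ t
    ⇓-then : ∀ {p b C₁ C₂ s t} → beval b (s p) ≡ true → D ⊢ C₁ , s ⇓ t →
      D ⊢ cif p b C₁ C₂ , s ⇓ t
    ⇓-else : ∀ {p b C₁ C₂ s t} → beval b (s p) ≡ false → D ⊢ C₂ , s ⇓ t →
      D ⊢ cif p b C₁ C₂ , s ⇓ t
    ⇓-call : ∀ {X s t} → D ⊢ proj₂ (D X) , s ⇓ t → D ⊢ call X , s ⇓ t
    ⇓-rtcall : ∀ {X ps C s t} → D ⊢ C , s ⇓ t → D ⊢ rtcall X ps C , s ⇓ t

  module _ {D : ProcDefs} where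

    ⇓-resp-≈ : ∀ {C s s' t} → s ≈ s' → D ⊢ C , s ⇓ t → D ⊢ C , s' ⇓ t
    ⇓-resp-≈ s≈s' (⇓-end s≈t) = ⇓-end (≈-trans (≈-sym s≈s') s≈t)
    ⇓-resp-≈ {s = s} {s'} s≈s' (⇓-com {p} {e} {q} {x} ⇓t) =
      ⇓-com (⇓-resp-≈ (≈-trans (update-cong q x _ s≈s')
                               (update-cong-val s' q x (eval-resp-≈ e p s≈s'))) ⇓t)
    ⇓-resp-≈ s≈s' (⇓-sel ⇓t) = ⇓-sel (⇓-resp-≈ s≈s' ⇓t)
    ⇓-resp-≈ s≈s' (⇓-then {p} {b} b≡t ⇓t) =
      ⇓-then (trans (sym (beval-resp-≈ b p s≈s')) b≡t) (⇓-resp-≈ s≈s' ⇓t)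
    ⇓-resp-≈ s≈s' (⇓-else {p} {b} b≡f ⇓t) =
      ⇓-else (trans (sym (beval-resp-≈ b p s≈s')) b≡f) (⇓-resp-≈ s≈s' ⇓t)
    ⇓-resp-≈ s≈s' (⇓-call ⇓t) = ⇓-call (⇓-resp-≈ s≈s' ⇓t)
    ⇓-resp-≈ s≈s' (⇓-rtcall ⇓t) = ⇓-rtcall (⇓-resp-≈ s≈s' ⇓t)

    ⇓-deterministic : ∀ {C s t t'} → D ⊢ C , s ⇓ t → D ⊢ C , s ⇓ t' → t ≈ t'
    ⇓-deterministic (⇓-end s≈t) (⇓-end s≈t') = ≈-trans (≈-sym s≈t) s≈t'
    ⇓-deterministic (⇓-com ⇓t) (⇓-com ⇓t') = ⇓-deterministic ⇓t ⇓t'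
    ⇓-deterministic (⇓-sel ⇓t) (⇓-sel ⇓t') = ⇓-deterministic ⇓t ⇓t'
    ⇓-deterministic (⇓-then _ ⇓t) (⇓-then _ ⇓t') = ⇓-deterministic ⇓t ⇓t'
    ⇓-deterministic (⇓-then b≡t _) (⇓-else b≡f _) with trans (sym b≡t) b≡f
    ... | ()
    ⇓-deterministic (⇓-else b≡f _) (⇓-then b≡t _) with trans (sym b≡f) b≡t
    ... | ()
    ⇓-deterministic (⇓-else _ ⇓t) (⇓-else _ ⇓t') = ⇓-deterministic ⇓t ⇓t'
    ⇓-deterministic (⇓-call ⇓t) (⇓-call ⇓t') = ⇓-deterministic ⇓t ⇓t'
    ⇓-deterministic (⇓-rtcall ⇓t) (⇓-rtcall ⇓t') = ⇓-deterministic ⇓t ⇓t'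

    step-preserves-nonparticipant : ∀ {C s ρ C' s' r} → Step D C s ρ C' s' →
      r ∉ pnR ρ → s r ≗ s' r
    step-preserves-nonparticipant {s = s} (s-com {x = x} {v = v} _ s'≈) r∉ρ y =
      trans (sym (update-≢ s x v (λ r≡q → r∉ρ (there (here r≡q))) y)) (sym (s'≈ _ y))
    step-preserves-nonparticipant (s-sel s≈) _ y = s≈ _ y
    step-preserves-nonparticipant (s-then _ s≈) _ y = s≈ _ y
    step-preserves-nonparticipant (s-else _ s≈) _ y = s≈ _ y
    step-preserves-nonparticipant (s-delay-int _ st) r∉ρ = step-preserves-nonparticipant st r∉ρ
    step-preserves-nonparticipant (s-delay-if _ st _) r∉ρ = step-preserves-nonparticipant st r∉ρ
    step-preserves-nonparticipant (s-delay-rt _ st) r∉ρ = step-preserves-nonparticipant st r∉ρ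
    step-preserves-nonparticipant (s-call-single s≈ _ _) _ y = s≈ _ y
    step-preserves-nonparticipant (s-call-multi s≈ _ _) _ y = s≈ _ y
    step-preserves-nonparticipant (s-rt-multi s≈ _ _) _ y = s≈ _ y
    step-preserves-nonparticipant (s-rt-single s≈ _ _) _ y = s≈ _ y

    step-update-nonparticipant : ∀ {C s ρ C' s'} q x v → q ∉ pnR ρ →
      Step D C s ρ C' s' → Step D C (update s q x v) ρ C' (update s' q x v)
    step-update-nonparticipant {s = s} q x v q∉ρ (s-com {p} {e} {q'} {x'} v≡ s'≈) =
      s-com (trans v≡ (sym (eval-ext e _ (s p) (update-≢ s x v (λ p≡q → q∉ρ (here (sym p≡q)))))))
            (≈-trans (update-cong q x v s'≈)
                     (update-comm s q' x' _ q x v (λ q'≡q → q∉ρ (there (here (sym q'≡q))))))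
    step-update-nonparticipant q x v _ (s-sel s≈) = s-sel (update-cong q x v s≈)
    step-update-nonparticipant {s = s} q x v q∉ρ (s-then {p} {b} b≡t s≈) =
      s-then (trans (beval-ext b _ (s p) (update-≢ s x v (λ p≡q → q∉ρ (here (sym p≡q))))) b≡t)
             (update-cong q x v s≈)
    step-update-nonparticipant {s = s} q x v q∉ρ (s-else {p} {b} b≡f s≈) =
      s-else (trans (beval-ext b _ (s p) (update-≢ s x v (λ p≡q → q∉ρ (here (sym p≡q))))) b≡f)
             (update-cong q x v s≈)
    step-update-nonparticipant q x v q∉ρ (s-delay-int d st) =
      s-delay-int d (step-update-nonparticipant q x v q∉ρ st)
    step-update-nonparticipant q x v q∉ρ (s-delay-if d st₁ st₂) =
      s-delay-if d (step-update-nonparticipant q x v q∉ρ st₁)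
                   (step-update-nonparticipant q x v q∉ρ st₂)
    step-update-nonparticipant q x v q∉ρ (s-delay-rt d st) =
      s-delay-rt d (step-update-nonparticipant q x v q∉ρ st)
    step-update-nonparticipant q x v _ (s-call-single s≈ m l) = s-call-single (update-cong q x v s≈) m l
    step-update-nonparticipant q x v _ (s-call-multi s≈ m l) = s-call-multi (update-cong q x v s≈) m l
    step-update-nonparticipant q x v _ (s-rt-multi s≈ m l) = s-rt-multi (update-cong q x v s≈) m l
    step-update-nonparticipant q x v _ (s-rt-single s≈ m l) = s-rt-single (update-cong q x v s≈) m l

    step-reflects-⇓ : ∀ C {s ρ C' s' t} → Step D C s ρ C' s' →
      D ⊢ C' , s' ⇓ t → D ⊢ C , s ⇓ t
    step-reflects-⇓ (_ ＠ _ ︔ _) (s-com refl s'≈) ⇓t = ⇓-com (⇓-resp-≈ s'≈ ⇓t)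
    step-reflects-⇓ (_ ＠ _ ︔ _) (s-sel s≈) ⇓t = ⇓-sel (⇓-resp-≈ (≈-sym s≈) ⇓t)
    step-reflects-⇓ (cif _ _ _ _) (s-then b≡t s≈) ⇓t = ⇓-then b≡t (⇓-resp-≈ (≈-sym s≈) ⇓t)
    step-reflects-⇓ (cif _ _ _ _) (s-else b≡f s≈) ⇓t = ⇓-else b≡f (⇓-resp-≈ (≈-sym s≈) ⇓t)
    step-reflects-⇓ (com p e q x ＠ a ︔ C) {s} {s' = s'} (s-delay-int d st) (⇓-com ⇓t) =
      ⇓-com (step-reflects-⇓ C (step-update-nonparticipant q x _ (d (there (here refl))) st)
              (⇓-resp-≈ (update-cong-val s' q x (eval-ext e (s' p) (s p) p-unchanged)) ⇓t))
      where
        p-unchanged : s' p ≗ s p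
        p-unchanged y = sym (step-preserves-nonparticipant st (d (here refl)) y)
    step-reflects-⇓ (sel p q l ＠ a ︔ C) (s-delay-int d st) (⇓-sel ⇓t) =
      ⇓-sel (step-reflects-⇓ C st ⇓t)
    step-reflects-⇓ (cif p b C₁ C₂) (s-delay-if p∉ρ st₁ st₂) (⇓-then b≡t ⇓t) =
      ⇓-then (trans (beval-ext b _ _ (step-preserves-nonparticipant st₁ p∉ρ)) b≡t)
             (step-reflects-⇓ C₁ st₁ ⇓t)
    step-reflects-⇓ (cif p b C₁ C₂) (s-delay-if p∉ρ st₁ st₂) (⇓-else b≡f ⇓t) =
      ⇓-else (trans (beval-ext b _ _ (step-preserves-nonparticipant st₂ p∉ρ)) b≡f)
             (step-reflects-⇓ C₂ st₂ ⇓t)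
    step-reflects-⇓ (rtcall X ps C) (s-delay-rt _ st) (⇓-rtcall ⇓t) =
      ⇓-rtcall (step-reflects-⇓ C st ⇓t)
    step-reflects-⇓ (call X) (s-call-single s≈ _ _) ⇓t = ⇓-call (⇓-resp-≈ (≈-sym s≈) ⇓t)
    step-reflects-⇓ (call X) (s-call-multi s≈ _ _) (⇓-rtcall ⇓t) = ⇓-call (⇓-resp-≈ (≈-sym s≈) ⇓t)
    step-reflects-⇓ (rtcall X ps C) (s-rt-multi s≈ _ _) (⇓-rtcall ⇓t) = ⇓-rtcall (⇓-resp-≈ (≈-sym s≈) ⇓t)
    step-reflects-⇓ (rtcall X ps C) (s-rt-single s≈ _ _) ⇓t = ⇓-rtcall (⇓-resp-≈ (≈-sym s≈) ⇓t)

  steps-to-end⇒⇓ : ∀ {c ls c'} → CSteps c ls c' → Program.main (proj₁ c') ≡ end →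
    Program.defs (proj₁ c) ⊢ Program.main (proj₁ c) , proj₂ c ⇓ proj₂ c'
  steps-to-end⇒⇓ (done s≈s') refl = ⇓-end s≈s'
  steps-to-end⇒⇓ (more (cstep {C = C} st) rest) ends = step-reflects-⇓ C st (steps-to-end⇒⇓ rest ends)

mainTheorem9 : (S : Sig) → let open Choreographies S in
    ∀ (c c₁ c₂ : Config) (ls₁ ls₂ : List ObsLabel) →
    CSteps c ls₁ c₁ → CSteps c ls₂ c₂ →
    Program.main (proj₁ c₁) ≡ end → Program.main (proj₁ c₂) ≡ end →
    proj₂ c₁ ≈ proj₂ c₂
mainTheorem9 S c c₁ c₂ _ _ run₁ run₂ ends₁ ends₂ =
  ⇓-deterministic S (steps-to-end⇒⇓ S run₁ ends₁) (steps-to-end⇒⇓ S run₂ ends₂)
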